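{- For every $n\ge1$, there is a bijection between the set of indecomposable, noncrossing, nonnesting set partitions of $[n]$ and the set of indecomposable permutations in $\mathcal{S}_n(321,3412)$.
   Context: A set partition of $[n]$ is represented by its arc diagram: an arc $(i,j)$ with $i<j$ joins each pair of elements that are consecutive (in increasing order) within the same block. Two arcs $(i_1,j_1),(i_2,j_2)$ form a crossing if $i_1<i_2<j_1<j_2$ and a nesting if $i_1<i_2<j_2<j_1$; a partition is noncrossing (nonnesting) if it has no crossing (nesting). A partition of $[n]$ is indecomposable if no subset of its blocks is a partition of $[k]$ for some $k<n$. A permutation is indecomposable if it is not a direct sum $\pi\oplus\tau$ of two nonempty permutations, where $\pi\oplus\tau$ is $\pi$ followed by $\tau$ with all entries shifted up by the size of $\pi$. $\mathcal{S}_n(321,3412)$ is the set of permutations of $[n]$ (one-line notation) having no subsequence in the same relative order as $321$ or as $3412$. -}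

module Defs where

open import Data.Nat using (ℕ; _<_; _≤_)
open import Data.Fin using (Fin; toℕ)
open import Data.Bool using (Bool; true; false)
open import Data.Vec using (Vec; lookup)
open import Data.Product using (Σ; ∃; _×_; _,_; proj₁)
open import Relation.Nullary using (¬_)
open import Relation.Binary.PropositionalEquality using (_≡_)
open import Relation.Binary.Bundles using (Setoid)
import Relation.Binary.PropositionalEquality as PE
import Relation.Binary.Construct.On as On
open import Level using (0ℓ)

-- Set partitions of [n] = {0,…,n-1} (0-indexed), given as equivalence
-- relations on Fin n, stored as an n×n Boolean matrix (so that equality
-- of partitions is plain propositional equality of matrices).

Rel : ℕ → Set
Rel n = Vec (Vec Bool n) n

_∼[_]_ : {n : ℕ} → Fin n → Rel n → Fin n → Set
i ∼[ R ] j = lookup (lookup R i) j ≡ true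

record IsSetPartition {n : ℕ} (R : Rel n) : Set where
  field
    refl  : ∀ i → i ∼[ R ] i
    sym   : ∀ i j → i ∼[ R ] j → j ∼[ R ] i
    trans : ∀ i j k → i ∼[ R ] j → j ∼[ R ] k → i ∼[ R ] k

Arc : {n : ℕ} → Rel n → Fin n → Fin n → Set
Arc R i j = toℕ i < toℕ j × i ∼[ R ] j
          × (∀ k → toℕ i < toℕ k → toℕ k < toℕ j → ¬ (i ∼[ R ] k))

HasCrossing : {n : ℕ} → Rel n → Set
HasCrossing {n} R = Σ (Fin n) λ i₁ → Σ (Fin n) λ j₁ → Σ (Fin n) λ i₂ → Σ (Fin n) λ j₂ →
  Arc R i₁ j₁ × Arc R i₂ j₂
  × toℕ i₁ < toℕ i₂ × toℕ i₂ < toℕ j₁ × toℕ j₁ < toℕ j₂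

HasNesting : {n : ℕ} → Rel n → Set
HasNesting {n} R = Σ (Fin n) λ i₁ → Σ (Fin n) λ j₁ → Σ (Fin n) λ i₂ → Σ (Fin n) λ j₂ →
  Arc R i₁ j₁ × Arc R i₂ j₂
  × toℕ i₁ < toℕ i₂ × toℕ i₂ < toℕ j₂ × toℕ j₂ < toℕ j₁

-- Decomposable: for some 1 ≤ k < n, the blocks meeting [k] form a
-- partition of [k], i.e. no block meets both [k] and its complement.
PartDecomposable : {n : ℕ} → Rel n → Set
PartDecomposable {n} R = Σ ℕ λ k → 1 ≤ k × k < n ×
  (∀ i j → toℕ i < k → k ≤ toℕ j → ¬ (i ∼[ R ] j))

IsNCNNIndecPartition : {n : ℕ} → Rel n → Set
IsNCNNIndecPartition R =
  IsSetPartition R × ¬ HasCrossing R × ¬ HasNesting R × ¬ PartDecomposable R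

IsPermutation : {n : ℕ} → Vec (Fin n) n → Set
IsPermutation {n} w = ∀ (i j : Fin n) → lookup w i ≡ lookup w j → i ≡ j

_at_ : {n : ℕ} → Vec (Fin n) n → Fin n → ℕ
w at i = toℕ (lookup w i)

Contains321 : {n : ℕ} → Vec (Fin n) n → Set
Contains321 {n} w = Σ (Fin n) λ a → Σ (Fin n) λ b → Σ (Fin n) λ c →
  toℕ a < toℕ b × toℕ b < toℕ c × w at c < w at b × w at b < w at a

Contains3412 : {n : ℕ} → Vec (Fin n) n → Set
Contains3412 {n} w = Σ (Fin n) λ a → Σ (Fin n) λ b → Σ (Fin n) λ c → Σ (Fin n) λ d →
  toℕ a < toℕ b × toℕ b < toℕ c × toℕ c < toℕ d
  × w at c < w at d × w at d < w at a × w at a < w at b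

-- w = π ⊕ τ with |π| = k, 1 ≤ k < n: the first k entries are exactly {0,…,k-1}
-- (for a permutation, equivalently all of them are < k).
PermDecomposable : {n : ℕ} → Vec (Fin n) n → Set
PermDecomposable {n} w = Σ ℕ λ k → 1 ≤ k × k < n ×
  (∀ i → toℕ i < k → w at i < k)

IsIndecAvoider : {n : ℕ} → Vec (Fin n) n → Set
IsIndecAvoider w =
  IsPermutation w × ¬ Contains321 w × ¬ Contains3412 w × ¬ PermDecomposable w

-- The two sets, as setoids whose equality is equality of the underlying
-- object (the property proofs are irrelevant).

NCNNIndecPartitions : ℕ → Setoid 0ℓ 0ℓ
NCNNIndecPartitions n =
  On.setoid {B = Σ (Rel n) IsNCNNIndecPartition} (PE.setoid (Rel n)) proj₁

IndecPerms321-3412 : ℕ → Setoid 0ℓ 0ℓ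
IndecPerms321-3412 n =
  On.setoid {B = Σ (Vec (Fin n) n) IsIndecAvoider} (PE.setoid (Vec (Fin n) n)) proj₁

{-# OPTIONS --safe #-}
module Submission where

-- Both sets are in bijection with the subsets B of [0, m] (n = m + 1) that contain 0 and m.
--
-- In a noncrossing nonnesting partition no two arcs overlap, and indecomposability puts an arc
-- over every cut; so the least element of a block with an arc is 0, and the partition consists
-- of one block B and singletons.
--
-- In an indecomposable permutation w as many points jump up over a cut as down (w is a
-- bijection), at least one jumps up, and two of each would form a 321 or a 3412. So every cut is
-- crossed exactly once each way, which forces w to be the cycle that climbs through
-- B = {x | x < w x} ∪ {m} and descends through the complement of B.

open import Defs
open import Data.Nat using (ℕ; _≤_)
open import Function.Bundles using (Bijection)

open import Data.Bool using (Bool; true; false; _∧_; _∨_; not; if_then_else_)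
open import Data.Bool.Properties
  using (∧-comm; ∨-zeroʳ; ∧-zeroʳ; ∧-identityʳ; ∧-inverseʳ; not-injective; ⇔→≡; ¬-not)
  renaming (_≟_ to _≟ᵇ_)
open import Data.Empty using (⊥; ⊥-elim)
open import Data.Fin using (Fin; toℕ) renaming (zero to fzero; suc to fsuc)
open import Data.Fin.Properties using (toℕ<n; toℕ-injective)
open import Data.Nat using (zero; suc; _+_; _∸_; _<_; z≤n; s≤s; _<ᵇ_; _≡ᵇ_)
open import Data.Nat.Properties
open import Data.Product using (Σ; ∃; ∃₂; _×_; _,_; proj₁; proj₂)
open import Data.Sum using (_⊎_; inj₁; inj₂)
open import Data.Vec using (Vec; lookup; tabulate)
open import Data.Vec.Properties using (lookup∘tabulate; tabulate∘lookup; tabulate-cong)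
open import Function.Bundles using (Inverse; mk⇔)
import Function.Construct.Composition as Composition
import Function.Construct.Symmetry as Symmetry
open import Function.Properties.Inverse using (Inverse⇒Bijection)
open import Level using (0ℓ)
open import Relation.Binary using (Setoid; tri<; tri≈; tri>)
import Relation.Binary.Construct.On as On
open import Relation.Binary.PropositionalEquality
import Relation.Binary.PropositionalEquality as PE
open import Relation.Nullary using (¬_; yes; no)
open import Relation.Nullary.Decidable using (_×-dec_)
open import Relation.Nullary.Reflects using (Reflects; ofʸ; ofⁿ; det; fromEquivalence)

module _ {A : Set} where

  reflects-true : ∀ {b} → Reflects A b → b ≡ true → A
  reflects-true (ofʸ a) refl = a

  reflects-false : ∀ {b} → Reflects A b → b ≡ false → ¬ A
  reflects-false (ofⁿ ¬a) refl = ¬a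

<⇒<ᵇ≡true : ∀ {a b} → a < b → (a <ᵇ b) ≡ true
<⇒<ᵇ≡true {a} {b} a<b = det (<ᵇ-reflects-< a b) (ofʸ a<b)

≥⇒<ᵇ≡false : ∀ {a b} → b ≤ a → (a <ᵇ b) ≡ false
≥⇒<ᵇ≡false {a} {b} b≤a = det (<ᵇ-reflects-< a b) (ofⁿ (≤⇒≯ b≤a))

<ᵇ≡true⇒< : ∀ {a b} → (a <ᵇ b) ≡ true → a < b
<ᵇ≡true⇒< {a} {b} = reflects-true (<ᵇ-reflects-< a b)

<ᵇ≡false⇒≥ : ∀ {a b} → (a <ᵇ b) ≡ false → b ≤ a
<ᵇ≡false⇒≥ {a} {b} e = ≮⇒≥ (reflects-false (<ᵇ-reflects-< a b) e)

≡ᵇ-reflects-≡ : ∀ a b → Reflects (a ≡ b) (a ≡ᵇ b)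
≡ᵇ-reflects-≡ a b = fromEquivalence (≡ᵇ⇒≡ a b) (≡⇒≡ᵇ a b)

≡⇒≡ᵇ≡true : ∀ {a b} → a ≡ b → (a ≡ᵇ b) ≡ true
≡⇒≡ᵇ≡true {a} {b} a≡b = det (≡ᵇ-reflects-≡ a b) (ofʸ a≡b)

≢⇒≡ᵇ≡false : ∀ {a b} → a ≢ b → (a ≡ᵇ b) ≡ false
≢⇒≡ᵇ≡false {a} {b} a≢b = det (≡ᵇ-reflects-≡ a b) (ofⁿ a≢b)

≡ᵇ≡true⇒≡ : ∀ {a b} → (a ≡ᵇ b) ≡ true → a ≡ b
≡ᵇ≡true⇒≡ {a} {b} = reflects-true (≡ᵇ-reflects-≡ a b)

true≢false : true ≢ false
true≢false ()

∧≡true⇒ : ∀ {x y} → x ∧ y ≡ true → x ≡ true × y ≡ true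
∧≡true⇒ {true} {true} _ = refl , refl

module _ (p : ℕ → Bool) where

  private
    firstFrom : ℕ → ℕ → ℕ
    firstFrom s zero = s
    firstFrom s (suc k) = if p s then s else firstFrom (suc s) k

    firstFrom-≥ : ∀ s k → s ≤ firstFrom s k
    firstFrom-≥ s zero = ≤-refl
    firstFrom-≥ s (suc k) with p s
    ... | true = ≤-refl
    ... | false = <⇒≤ (firstFrom-≥ (suc s) k)

    firstFrom-≤ : ∀ s k → firstFrom s k ≤ s + k
    firstFrom-≤ s zero = ≤-reflexive (sym (+-identityʳ s))
    firstFrom-≤ s (suc k) with p s
    ... | true = m≤m+n s (suc k)
    ... | false = ≤-trans (firstFrom-≤ (suc s) k) (≤-reflexive (sym (+-suc s k)))

    firstFrom-minimal : ∀ s k {y} → s ≤ y → y < firstFrom s k → p y ≡ false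
    firstFrom-minimal s zero s≤y y<s = ⊥-elim (≤⇒≯ s≤y y<s)
    firstFrom-minimal s (suc k) {y} s≤y y< with p s in ps
    ... | true = ⊥-elim (≤⇒≯ s≤y y<)
    ... | false with m≤n⇒m<n∨m≡n s≤y
    ...   | inj₁ s<y = firstFrom-minimal (suc s) k s<y y<
    ...   | inj₂ refl = ps

    firstFrom-satisfies : ∀ s k {y} → s ≤ y → y ≤ s + k → p y ≡ true → p (firstFrom s k) ≡ true
    firstFrom-satisfies s zero s≤y y≤ py rewrite ≤-antisym s≤y (≤-trans y≤ (≤-reflexive (+-identityʳ s))) = py
    firstFrom-satisfies s (suc k) s≤y y≤ py with p s in ps
    ... | true = ps
    ... | false with m≤n⇒m<n∨m≡n s≤y
    ...   | inj₁ s<y = firstFrom-satisfies (suc s) k s<y (≤-trans y≤ (≤-reflexive (+-suc s k))) py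
    ...   | inj₂ refl = ⊥-elim (true≢false (trans (sym py) ps))

  -- The least y ∈ [s, t] with p y (junk value t if there is none and s ≤ t).
  firstIn : ℕ → ℕ → ℕ
  firstIn s t = firstFrom s (t ∸ s)

  firstIn-≥ : ∀ s t → s ≤ firstIn s t
  firstIn-≥ s t = firstFrom-≥ s (t ∸ s)

  firstIn-≤ : ∀ {s t} → s ≤ t → firstIn s t ≤ t
  firstIn-≤ {s} {t} s≤t = ≤-trans (firstFrom-≤ s (t ∸ s)) (≤-reflexive (m+[n∸m]≡n s≤t))

  firstIn-minimal : ∀ s t {y} → s ≤ y → y < firstIn s t → p y ≡ false
  firstIn-minimal s t = firstFrom-minimal s (t ∸ s)

  firstIn-satisfies : ∀ {s t y} → s ≤ y → y ≤ t → p y ≡ true → p (firstIn s t) ≡ true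
  firstIn-satisfies {s} {t} s≤y y≤t =
    firstFrom-satisfies s (t ∸ s) s≤y (≤-trans y≤t (≤-reflexive (sym (m+[n∸m]≡n (≤-trans s≤y y≤t)))))

  firstIn-unique : ∀ {s t y} → s ≤ y → y ≤ t → p y ≡ true →
                   (∀ {z} → s ≤ z → z < y → p z ≡ false) → firstIn s t ≡ y
  firstIn-unique {s} {t} {y} s≤y y≤t py below with <-cmp (firstIn s t) y
  ... | tri≈ _ e _ = e
  ... | tri< lt _ _ = ⊥-elim (true≢false (trans (sym (firstIn-satisfies s≤y y≤t py)) (below (firstIn-≥ s t) lt)))
  ... | tri> _ _ gt = ⊥-elim (true≢false (trans (sym py) (firstIn-minimal s t s≤y gt)))

  -- The greatest y < x with p y (junk value 0 if there is none).
  lastBelow : ℕ → ℕ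
  lastBelow zero = zero
  lastBelow (suc x) = if p x then x else lastBelow x

  lastBelow-≤ : ∀ x → lastBelow x ≤ x
  lastBelow-≤ zero = z≤n
  lastBelow-≤ (suc x) with p x
  ... | true = n≤1+n x
  ... | false = m≤n⇒m≤1+n (lastBelow-≤ x)

  lastBelow-< : ∀ {x} → 0 < x → lastBelow x < x
  lastBelow-< {suc x} _ with p x
  ... | true = ≤-refl
  ... | false = s≤s (lastBelow-≤ x)

  lastBelow-maximal : ∀ x {y} → lastBelow x < y → y < x → p y ≡ false
  lastBelow-maximal (suc x) {y} lb<y y<1+x with p x in px
  ... | true = ⊥-elim (<⇒≱ lb<y (≤-pred y<1+x))
  ... | false with m≤n⇒m<n∨m≡n (≤-pred y<1+x)
  ...   | inj₁ y<x = lastBelow-maximal x lb<y y<x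
  ...   | inj₂ refl = px

  lastBelow-satisfies : ∀ x {y} → y < x → p y ≡ true → p (lastBelow x) ≡ true
  lastBelow-satisfies (suc x) {y} y<1+x py with p x in px
  ... | true = px
  ... | false with m≤n⇒m<n∨m≡n (≤-pred y<1+x)
  ...   | inj₁ y<x = lastBelow-satisfies x y<x py
  ...   | inj₂ refl = ⊥-elim (true≢false (trans (sym py) px))

  lastBelow-satisfies-or-0 : ∀ x → p (lastBelow x) ≡ true ⊎ lastBelow x ≡ 0
  lastBelow-satisfies-or-0 zero = inj₂ refl
  lastBelow-satisfies-or-0 (suc x) with p x in px
  ... | true = inj₁ px
  ... | false = lastBelow-satisfies-or-0 x

  lastBelow-unique : ∀ {x y} → y < x → (p y ≡ true ⊎ y ≡ 0) →
                     (∀ {z} → y < z → z < x → p z ≡ false) → lastBelow x ≡ y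
  lastBelow-unique {x} {y} y<x py above with <-cmp (lastBelow x) y
  ... | tri≈ _ e _ = e
  ... | tri< lt _ _ with py
  ...   | inj₁ t = ⊥-elim (true≢false (trans (sym t) (lastBelow-maximal x lt y<x)))
  ...   | inj₂ refl = ⊥-elim (n≮0 lt)
  lastBelow-unique {x} {y} y<x py above | tri> _ _ gt with lastBelow-satisfies-or-0 x
  ... | inj₁ t = ⊥-elim (true≢false (trans (sym t) (above gt (lastBelow-< (≤-<-trans z≤n y<x)))))
  ... | inj₂ e = ⊥-elim (n≮0 (subst (y <_) e gt))

-- Counting crossings of a cut

count : (ℕ → Bool) → ℕ → ℕ
count p zero = 0
count p (suc N) = if p N then suc (count p N) else count p N

count-cong : ∀ {p q} N → (∀ {i} → i < N → p i ≡ q i) → count p N ≡ count q N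
count-cong zero p≗q = refl
count-cong {p} {q} (suc N) p≗q
  rewrite p≗q {N} ≤-refl | count-cong {p} {q} N (λ i<N → p≗q (m<n⇒m<1+n i<N)) = refl

count-≤-suc : ∀ (p : ℕ → Bool) N → count p N ≤ count p (suc N)
count-≤-suc p N with p N
... | true = n≤1+n _
... | false = ≤-refl

count-split : ∀ (p r : ℕ → Bool) N → count p N ≡ count (λ i → p i ∧ r i) N + count (λ i → p i ∧ not (r i)) N
count-split p r zero = refl
count-split p r (suc N) with p N | r N
... | true | true = cong suc (count-split p r N)
... | true | false = trans (cong suc (count-split p r N)) (sym (+-suc _ _))
... | false | _ = count-split p r N

private
  count-remove : ∀ (q : ℕ → Bool) {M y} → y < M → q y ≡ true →
                 count q M ≡ suc (count (λ j → q j ∧ not (j ≡ᵇ y)) M)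
  count-remove q {suc M} {y} y<1+M qy with m≤n⇒m<n∨m≡n (≤-pred y<1+M)
  ... | inj₂ refl rewrite qy | ≡⇒≡ᵇ≡true (refl {x = y}) =
    cong suc (count-cong y (λ {i} i<y →
      sym (trans (cong (λ b → q i ∧ not b) (≢⇒≡ᵇ≡false (<⇒≢ i<y))) (∧-identityʳ (q i)))))
  ... | inj₁ y<M rewrite ≢⇒≡ᵇ≡false (>⇒≢ y<M) | ∧-identityʳ (q M) with q M
  ...   | true = cong suc (count-remove q y<M qy)
  ...   | false = count-remove q y<M qy

count-injection : ∀ {p q M} (f : ℕ → ℕ) N →
  (∀ {i} → i < N → p i ≡ true → f i < M × q (f i) ≡ true) →
  (∀ {i j} → i < N → j < N → p i ≡ true → p j ≡ true → f i ≡ f j → i ≡ j) →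
  count p N ≤ count q M
count-injection f zero into inj = z≤n
count-injection {p} {q} {M} f (suc N) into inj with p N in pN
... | false = count-injection f N (λ i<N → into (m<n⇒m<1+n i<N)) (λ i<N j<N → inj (m<n⇒m<1+n i<N) (m<n⇒m<1+n j<N))
... | true = begin
    suc (count p N)                              ≤⟨ s≤s rest ⟩
    suc (count (λ j → q j ∧ not (j ≡ᵇ f N)) M)   ≡⟨ sym (count-remove q fN<M qfN) ⟩
    count q M                                    ∎
  where
  open ≤-Reasoning
  fN<M = proj₁ (into ≤-refl pN)
  qfN = proj₂ (into ≤-refl pN)
  rest : count p N ≤ count (λ j → q j ∧ not (j ≡ᵇ f N)) M
  rest = count-injection f N
    (λ {i} i<N pi → let (fi<M , qfi) = into (m<n⇒m<1+n i<N) pi in fi<M ,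
       cong₂ (λ a b → a ∧ not b) qfi
         (≢⇒≡ᵇ≡false (λ fi≡fN → <⇒≢ i<N (inj (m<n⇒m<1+n i<N) ≤-refl pi pN fi≡fN))))
    (λ i<N j<N → inj (m<n⇒m<1+n i<N) (m<n⇒m<1+n j<N))

count-≥1⇒∃ : ∀ p N → 1 ≤ count p N → ∃ λ i → i < N × p i ≡ true
count-≥1⇒∃ p (suc N) c with p N in pN
... | true = N , ≤-refl , pN
... | false with count-≥1⇒∃ p N c
...   | i , i<N , pi = i , m<n⇒m<1+n i<N , pi

count-≥2⇒∃₂ : ∀ p N → 2 ≤ count p N → ∃₂ λ i j → i < j × j < N × p i ≡ true × p j ≡ true
count-≥2⇒∃₂ p (suc N) c with p N in pN
... | true with count-≥1⇒∃ p N (≤-pred c)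
...   | i , i<N , pi = i , N , i<N , ≤-refl , pi , pN
count-≥2⇒∃₂ p (suc N) c | false with count-≥2⇒∃₂ p N c
...   | i , j , i<j , j<N , pi , pj = i , j , i<j , m<n⇒m<1+n j<N , pi , pj

∃⇒count-≥1 : ∀ p {N i} → i < N → p i ≡ true → 1 ≤ count p N
∃⇒count-≥1 p {suc N} {i} i<1+N pi with m≤n⇒m<n∨m≡n (≤-pred i<1+N)
... | inj₂ refl rewrite pi = s≤s z≤n
... | inj₁ i<N = ≤-trans (∃⇒count-≥1 p i<N pi) (count-≤-suc p N)

∃₂⇒count-≥2 : ∀ p {N i j} → i < j → j < N → p i ≡ true → p j ≡ true → 2 ≤ count p N
∃₂⇒count-≥2 p {suc N} i<j j<1+N pi pj with m≤n⇒m<n∨m≡n (≤-pred j<1+N)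
... | inj₂ refl rewrite pj = s≤s (∃⇒count-≥1 p i<j pi)
... | inj₁ j<N = ≤-trans (∃₂⇒count-≥2 p i<j j<N pi pj) (count-≤-suc p N)

crossesUp crossesDown : (ℕ → ℕ) → ℕ → ℕ → Bool
crossesUp f K i = (i <ᵇ K) ∧ not (f i <ᵇ K)
crossesDown f K i = not (i <ᵇ K) ∧ (f i <ᵇ K)

crossesUp-intro : ∀ f {K i} → i < K → K ≤ f i → crossesUp f K i ≡ true
crossesUp-intro f i<K K≤fi rewrite <⇒<ᵇ≡true i<K | ≥⇒<ᵇ≡false K≤fi = refl

crossesDown-intro : ∀ f {K i} → K ≤ i → f i < K → crossesDown f K i ≡ true
crossesDown-intro f K≤i fi<K rewrite <⇒<ᵇ≡true fi<K | ≥⇒<ᵇ≡false K≤i = refl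

crossesUp-elim : ∀ f {K} i → crossesUp f K i ≡ true → i < K × K ≤ f i
crossesUp-elim f {K} i e with i <ᵇ K in i<K | f i <ᵇ K in fi<K
... | true | false = <ᵇ≡true⇒< i<K , <ᵇ≡false⇒≥ fi<K

crossesDown-elim : ∀ f {K} i → crossesDown f K i ≡ true → K ≤ i × f i < K
crossesDown-elim f {K} i e with i <ᵇ K in i<K | f i <ᵇ K in fi<K
... | false | true = <ᵇ≡false⇒≥ i<K , <ᵇ≡true⇒< fi<K

-- f maps the points with image below K injectively into [0, K), and the others into [K, N).
crossings-balanced : ∀ {N f} → (∀ {i} → i < N → f i < N) →
  (∀ {i j} → i < N → j < N → f i ≡ f j → i ≡ j) →
  ∀ K → count (crossesUp f K) N ≡ count (crossesDown f K) N
crossings-balanced {N} {f} bounded injective K =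
  ≤-antisym (+-cancelʳ-≤ stay-above _ _ (subst₂ _≤_ images-above points-above (count-image (λ b → not b))))
            (+-cancelˡ-≤ stay-below _ _ (subst₂ _≤_ images-below points-below (count-image (λ b → b))))
  where
  below imageBelow : ℕ → Bool
  below i = i <ᵇ K
  imageBelow i = f i <ᵇ K
  stay-below = count (λ i → below i ∧ imageBelow i) N
  stay-above = count (λ i → not (below i) ∧ not (imageBelow i)) N

  count-image : (g : Bool → Bool) → count (λ i → g (imageBelow i)) N ≤ count (λ i → g (below i)) N
  count-image g = count-injection f N (λ i<N g-fi → bounded i<N , g-fi) (λ i<N j<N _ _ → injective i<N j<N)

  swap-∧ : ∀ (p q : ℕ → Bool) → count (λ i → p i ∧ q i) N ≡ count (λ i → q i ∧ p i) N
  swap-∧ p q = count-cong N (λ {i} _ → ∧-comm (p i) (q i))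

  points-below : count below N ≡ stay-below + count (crossesUp f K) N
  points-below = count-split below imageBelow N

  points-above : count (λ i → not (below i)) N ≡ count (crossesDown f K) N + stay-above
  points-above = count-split (λ i → not (below i)) imageBelow N

  images-below : count imageBelow N ≡ stay-below + count (crossesDown f K) N
  images-below = trans (count-split imageBelow below N)
    (cong₂ _+_ (swap-∧ imageBelow below) (swap-∧ imageBelow (λ i → not (below i))))

  images-above : count (λ i → not (imageBelow i)) N ≡ count (crossesUp f K) N + stay-above
  images-above = trans (count-split (λ i → not (imageBelow i)) below N)
    (cong₂ _+_ (swap-∧ (λ i → not (imageBelow i)) below)
               (swap-∧ (λ i → not (imageBelow i)) (λ i → not (below i))))

-- Permutations of [0, m] as maps ℕ → ℕ

AtMostOneUpCrossing AtMostOneDownCrossing NoPositiveFixedPoint : ℕ → (ℕ → ℕ) → Set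
AtMostOneUpCrossing m f = ∀ {K x y} → K ≤ m → x < K → y < K → K ≤ f x → K ≤ f y → x ≡ y
AtMostOneDownCrossing m f = ∀ {K x y} → x ≤ m → y ≤ m → K ≤ x → K ≤ y → f x < K → f y < K → x ≡ y
NoPositiveFixedPoint m f = ∀ {x} → 0 < x → x ≤ m → f x ≢ x

module _ {m f} (up : AtMostOneUpCrossing m f) (down : AtMostOneDownCrossing m f)
         (no-fix : NoPositiveFixedPoint m f) where

  unique-crossings⇒avoids-321 : ∀ {a b c} → a < b → b < c → c ≤ m → f c < f b → f b < f a → ⊥
  unique-crossings⇒avoids-321 {a} {b} {c} a<b b<c c≤m fc<fb fb<fa with <-cmp b (f b)
  ... | tri< b<fb _ _ = <⇒≢ a<b (up (≤-trans b<c c≤m) (m<n⇒m<1+n a<b) ≤-refl (<-trans b<fb fb<fa) b<fb)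
  ... | tri≈ _ b≡fb _ = no-fix (≤-<-trans z≤n a<b) (≤-trans (<⇒≤ b<c) c≤m) (sym b≡fb)
  ... | tri> _ _ fb<b =
    <⇒≢ b<c (down (≤-trans (<⇒≤ b<c) c≤m) c≤m ≤-refl (<⇒≤ b<c) fb<b (<-trans fc<fb fb<b))

  unique-crossings⇒avoids-3412 : ∀ {a b c d} → a < b → b < c → c < d → d ≤ m →
                                 f c < f d → f d < f a → f a < f b → ⊥
  unique-crossings⇒avoids-3412 {a} {b} {c} {d} a<b b<c c<d d≤m fc<fd fd<fa fa<fb with b <? f a
  ... | yes b<fa = <⇒≢ a<b (up (≤-trans (<-trans b<c c<d) d≤m) (m<n⇒m<1+n a<b) ≤-refl b<fa (<-trans b<fa fa<fb))
  ... | no b≮fa = <⇒≢ c<d (down (≤-trans (<⇒≤ c<d) d≤m) d≤m ≤-refl (<⇒≤ c<d) (<-trans fc<fd fd<c) fd<c)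
    where fd<c = <-≤-trans fd<fa (≤-trans (≮⇒≥ b≮fa) (<⇒≤ b<c))

ascends : ℕ → (ℕ → Bool) → ℕ → Bool
ascends m b x = b x ∧ not (x ≡ᵇ m)

-- For 0, m ∈ B = {x | b x}: the cycle 0 → b₁ → ⋯ → bₖ = m → cᵣ → ⋯ → c₁ → 0, where b₁ < ⋯ < bₖ
-- lists B ∖ {0} and c₁ < ⋯ < cᵣ lists [0, m] ∖ B; the junk value 0 of lastBelow closes the cycle.
cycleOf : ℕ → (ℕ → Bool) → ℕ → ℕ
cycleOf m b x = if ascends m b x then firstIn b (suc x) m else lastBelow (λ y → not (b y)) x

cycleOf-ascent : ∀ m b {x} → ascends m b x ≡ true → cycleOf m b x ≡ firstIn b (suc x) m
cycleOf-ascent m b asc rewrite asc = refl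

cycleOf-descent : ∀ m b {x} → ascends m b x ≡ false → cycleOf m b x ≡ lastBelow (λ y → not (b y)) x
cycleOf-descent m b asc rewrite asc = refl

excedanceSet : ℕ → (ℕ → ℕ) → ℕ → Bool
excedanceSet m f x = (x <ᵇ f x) ∨ (x ≡ᵇ m)

record IsIndecAvoiderOn (m : ℕ) (f : ℕ → ℕ) : Set where
  field
    bounded : ∀ {x} → x ≤ m → f x ≤ m
    injective : ∀ {x y} → x ≤ m → y ≤ m → f x ≡ f y → x ≡ y
    avoids-321 : ∀ {a b c} → a < b → b < c → c ≤ m → f c < f b → f b < f a → ⊥
    avoids-3412 : ∀ {a b c d} → a < b → b < c → c < d → d ≤ m → f c < f d → f d < f a → f a < f b → ⊥
    indecomposable : ∀ {K} → 1 ≤ K → K ≤ m → ∃ λ i → i < K × K ≤ f i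

module IsIndecAvoiderOn-Properties {m f} (av : IsIndecAvoiderOn m f) where
  open IsIndecAvoiderOn av

  private
    balanced : ∀ K → count (crossesUp f K) (suc m) ≡ count (crossesDown f K) (suc m)
    balanced = crossings-balanced (λ x<1+m → s≤s (bounded (≤-pred x<1+m)))
                                  (λ x<1+m y<1+m → injective (≤-pred x<1+m) (≤-pred y<1+m))

    -- Such x, y, p, q always contain a 321 or a 3412.
    two-up-two-down : ∀ {K x y p q} → x < y → y < p → p < q → q ≤ m →
                      K ≤ f x → K ≤ f y → f p < K → f q < K → ⊥
    two-up-two-down {K} {x} {y} {p} {q} x<y y<p p<q q≤m K≤fx K≤fy fp<K fq<K with <-cmp (f x) (f y)
    ... | tri≈ _ fx≡fy _ = <⇒≢ x<y (injective x≤m y≤m fx≡fy)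
      where y≤m = ≤-trans (<⇒≤ (<-trans y<p p<q)) q≤m
            x≤m = ≤-trans (<⇒≤ x<y) y≤m
    ... | tri> _ _ fy<fx = avoids-321 x<y y<p (≤-trans (<⇒≤ p<q) q≤m) (<-≤-trans fp<K K≤fy) fy<fx
    ... | tri< fx<fy _ _ with <-cmp (f p) (f q)
    ...   | tri< fp<fq _ _ = avoids-3412 x<y y<p p<q q≤m fp<fq (<-≤-trans fq<K K≤fx) fx<fy
    ...   | tri≈ _ fp≡fq _ = <⇒≢ p<q (injective (≤-trans (<⇒≤ p<q) q≤m) q≤m fp≡fq)
    ...   | tri> _ _ fq<fp = avoids-321 y<p p<q q≤m fq<fp (<-≤-trans fp<K K≤fy)

    two-up-crossings-impossible : ∀ {K x y} → x < y → y < K → K ≤ m → K ≤ f x → K ≤ f y → ⊥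
    two-up-crossings-impossible {K} x<y y<K K≤m K≤fx K≤fy
      with count-≥2⇒∃₂ (crossesDown f K) (suc m)
             (subst (2 ≤_) (balanced K) (∃₂⇒count-≥2 (crossesUp f K) x<y (s≤s (≤-trans (<⇒≤ y<K) K≤m))
               (crossesUp-intro f (<-trans x<y y<K) K≤fx) (crossesUp-intro f y<K K≤fy)))
    ... | p , q , p<q , q<1+m , down-p , down-q with crossesDown-elim f p down-p | crossesDown-elim f q down-q
    ...   | K≤p , fp<K | _ , fq<K = two-up-two-down x<y (<-≤-trans y<K K≤p) p<q (≤-pred q<1+m) K≤fx K≤fy fp<K fq<K

    two-down-crossings-impossible : ∀ {K p q} → p < q → q ≤ m → K ≤ p → f p < K → f q < K → ⊥
    two-down-crossings-impossible {K} p<q q≤m K≤p fp<K fq<K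
      with count-≥2⇒∃₂ (crossesUp f K) (suc m)
             (subst (2 ≤_) (sym (balanced K)) (∃₂⇒count-≥2 (crossesDown f K) p<q (s≤s q≤m)
               (crossesDown-intro f K≤p fp<K) (crossesDown-intro f (≤-trans K≤p (<⇒≤ p<q)) fq<K)))
    ... | x , y , x<y , _ , up-x , up-y with crossesUp-elim f x up-x | crossesUp-elim f y up-y
    ...   | _ , K≤fx | y<K , K≤fy = two-up-two-down x<y (<-≤-trans y<K K≤p) p<q q≤m K≤fx K≤fy fp<K fq<K

  atMostOneUpCrossing : AtMostOneUpCrossing m f
  atMostOneUpCrossing K≤m x<K y<K K≤fx K≤fy =
    ≤-antisym (≮⇒≥ (λ y<x → two-up-crossings-impossible y<x x<K K≤m K≤fy K≤fx))
              (≮⇒≥ (λ x<y → two-up-crossings-impossible x<y y<K K≤m K≤fx K≤fy))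

  atMostOneDownCrossing : AtMostOneDownCrossing m f
  atMostOneDownCrossing x≤m y≤m K≤x K≤y fx<K fy<K =
    ≤-antisym (≮⇒≥ (λ y<x → two-down-crossings-impossible y<x x≤m K≤y fy<K fx<K))
              (≮⇒≥ (λ x<y → two-down-crossings-impossible x<y y≤m K≤x fx<K fy<K))

  downCrossing : ∀ {K} → 1 ≤ K → K ≤ m → ∃ λ d → K ≤ d × d ≤ m × f d < K
  downCrossing {K} 1≤K K≤m with indecomposable 1≤K K≤m
  ... | i , i<K , K≤fi with count-≥1⇒∃ (crossesDown f K) (suc m)
        (subst (1 ≤_) (balanced K)
          (∃⇒count-≥1 (crossesUp f K) (s≤s (≤-trans (<⇒≤ i<K) K≤m)) (crossesUp-intro f i<K K≤fi)))
  ...   | d , d<1+m , down-d with crossesDown-elim f d down-d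
  ...     | K≤d , fd<K = d , K≤d , ≤-pred d<1+m , fd<K

  noPositiveFixedPoint : NoPositiveFixedPoint m f
  noPositiveFixedPoint {x} 0<x x≤m fx≡x with m≤n⇒m<n∨m≡n x≤m
  ... | inj₂ refl with indecomposable 0<x ≤-refl
  ...   | i , i<x , x≤fi =
    <⇒≢ i<x (injective (<⇒≤ i<x) ≤-refl (trans (≤-antisym (bounded (<⇒≤ i<x)) x≤fi) (sym fx≡x)))
  noPositiveFixedPoint {x} 0<x x≤m fx≡x | inj₁ x<m with indecomposable 0<x (<⇒≤ x<m) | downCrossing (s≤s z≤n) x<m
  ... | u , u<x , x≤fu | d , x<d , d≤m , fd≤x = avoids-321 u<x x<d d≤m fd<fx fx<fu
    where
    fx<fu : f x < f u
    fx<fu = subst (_< f u) (sym fx≡x)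
      (≤∧≢⇒< x≤fu (λ x≡fu →
        <⇒≢ u<x (injective (≤-trans (<⇒≤ u<x) x≤m) x≤m (trans (sym x≡fu) (sym fx≡x)))))
    fd<fx : f d < f x
    fd<fx = subst (f d <_) (sym fx≡x)
      (≤∧≢⇒< (≤-pred fd≤x) (λ fd≡x → <⇒≢ x<d (injective x≤m d≤m (trans fx≡x (sym fd≡x)))))

  excedance-image-excedance : ∀ {x} → x ≤ m → x < f x → f x < m → f x < f (f x)
  excedance-image-excedance {x} x≤m x<fx fx<m with <-cmp (f x) (f (f x))
  ... | tri< fx<ffx _ _ = fx<ffx
  ... | tri≈ _ fx≡ffx _ = ⊥-elim (noPositiveFixedPoint (≤-<-trans z≤n x<fx) (<⇒≤ fx<m) (sym fx≡ffx))
  ... | tri> _ _ ffx<fx with indecomposable (s≤s z≤n) fx<m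
  ...   | u , u<1+fx , fx<fu with m≤n⇒m<n∨m≡n (≤-pred u<1+fx)
  ...     | inj₂ refl = ⊥-elim (<-asym ffx<fx fx<fu)
  ...     | inj₁ u<fx =
    ⊥-elim (<⇒≢ fx<fu (cong f (atMostOneUpCrossing (<⇒≤ fx<m) x<fx u<fx ≤-refl (<⇒≤ fx<fu))))

  no-excedance-inside-excedance : ∀ {x z} → x ≤ m → x < z → z < f x → z < f z → ⊥
  no-excedance-inside-excedance {x} {z} x≤m x<z z<fx z<fz =
    <⇒≢ x<z (atMostOneUpCrossing (≤-trans z<fx (bounded x≤m)) (m<n⇒m<1+n x<z) ≤-refl z<fx z<fz)

  deficiency-image-not-excedance : ∀ {x} → x ≤ m → f x < x → 0 < f x → f x < f (f x) → ⊥
  deficiency-image-not-excedance {x} x≤m fx<x 0<fx fx<ffx with indecomposable 0<fx (≤-trans (<⇒≤ fx<x) x≤m)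
  ... | u , u<fx , fx≤fu = <⇒≢ u<fx (atMostOneUpCrossing (≤-trans fx<x x≤m) (m<n⇒m<1+n u<fx) ≤-refl fx<fu fx<ffx)
    where
    fx<fu : f x < f u
    fx<fu = ≤∧≢⇒< fx≤fu (λ fx≡fu → <⇒≢ (<-trans u<fx fx<x)
              (injective (≤-trans (<⇒≤ (<-trans u<fx fx<x)) x≤m) x≤m (sym fx≡fu)))

  between-deficiency-excedance : ∀ {x y} → x ≤ m → f x < y → y < x → y < f y
  between-deficiency-excedance {x} {y} x≤m fx<y y<x with <-cmp y (f y)
  ... | tri< y<fy _ _ = y<fy
  ... | tri≈ _ y≡fy _ =
    ⊥-elim (noPositiveFixedPoint (≤-<-trans z≤n fx<y) (≤-trans (<⇒≤ y<x) x≤m) (sym y≡fy))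
  ... | tri> _ _ fy<y =
    ⊥-elim (<⇒≢ y<x (atMostOneDownCrossing (≤-trans (<⇒≤ y<x) x≤m) x≤m ≤-refl (<⇒≤ y<x) fy<y fx<y))

  0∈excedanceSet : excedanceSet m f 0 ≡ true
  0∈excedanceSet with 0 <? m
  ... | no 0≮m = trans (cong ((0 <ᵇ f 0) ∨_) (≡⇒≡ᵇ≡true (sym (n≤0⇒n≡0 (≮⇒≥ 0≮m))))) (∨-zeroʳ _)
  ... | yes 0<m with indecomposable ≤-refl 0<m
  ...   | zero , _ , 0<f0 rewrite <⇒<ᵇ≡true 0<f0 = refl
  ...   | suc _ , s≤s () , _

  module _ {b : ℕ → Bool} (b≗excedanceSet : ∀ x → x ≤ m → b x ≡ excedanceSet m f x) where

    private
      excedance∈b : ∀ {x} → x ≤ m → x < f x → b x ≡ true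
      excedance∈b {x} x≤m x<fx = trans (b≗excedanceSet x x≤m) (cong (_∨ (x ≡ᵇ m)) (<⇒<ᵇ≡true x<fx))

      m∈b : b m ≡ true
      m∈b = trans (b≗excedanceSet m ≤-refl)
                  (trans (cong ((m <ᵇ f m) ∨_) (≡⇒≡ᵇ≡true {m} refl)) (∨-zeroʳ (m <ᵇ f m)))

      non-excedance∉b : ∀ {x} → x ≤ m → f x ≤ x → x ≢ m → b x ≡ false
      non-excedance∉b {x} x≤m fx≤x x≢m =
        trans (b≗excedanceSet x x≤m) (cong₂ _∨_ (≥⇒<ᵇ≡false fx≤x) (≢⇒≡ᵇ≡false x≢m))

      excedance-≡cycleOf : ∀ {x} → x ≤ m → x < f x → f x ≡ cycleOf m b x
      excedance-≡cycleOf {x} x≤m x<fx =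
        sym (trans (cycleOf-ascent m b ascent) (firstIn-unique b x<fx (bounded x≤m) fx∈b skipped))
        where
        x≢m : x ≢ m
        x≢m x≡m = <⇒≱ x<fx (subst (f x ≤_) (sym x≡m) (bounded x≤m))
        ascent : ascends m b x ≡ true
        ascent rewrite excedance∈b x≤m x<fx | ≢⇒≡ᵇ≡false x≢m = refl
        fx∈b : b (f x) ≡ true
        fx∈b with m≤n⇒m<n∨m≡n (bounded x≤m)
        ... | inj₁ fx<m = excedance∈b (<⇒≤ fx<m) (excedance-image-excedance x≤m x<fx fx<m)
        ... | inj₂ fx≡m = subst (λ y → b y ≡ true) (sym fx≡m) m∈b
        skipped : ∀ {z} → suc x ≤ z → z < f x → b z ≡ false
        skipped x<z z<fx =
          non-excedance∉b (<⇒≤ z<m) (≮⇒≥ (no-excedance-inside-excedance x≤m x<z z<fx)) (<⇒≢ z<m)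
          where z<m = <-≤-trans z<fx (bounded x≤m)

      fixed-point-≡cycleOf : ∀ {x} → x ≤ m → f x ≡ x → f x ≡ cycleOf m b x
      fixed-point-≡cycleOf {x} x≤m fx≡x = begin
          f x            ≡⟨ fx≡x ⟩
          x              ≡⟨ x≡0 ⟩
          0              ≡⟨ sym (cycleOf-descent m b 0-descends) ⟩
          cycleOf m b 0  ≡⟨ cong (cycleOf m b) (sym x≡0) ⟩
          cycleOf m b x  ∎
        where
        open ≡-Reasoning
        x≡0 : x ≡ 0
        x≡0 = n≤0⇒n≡0 (≮⇒≥ (λ 0<x → noPositiveFixedPoint 0<x x≤m fx≡x))
        f0≡0 : f 0 ≡ 0
        f0≡0 = trans (cong f (sym x≡0)) (trans fx≡x x≡0)
        0-descends : ascends m b 0 ≡ false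
        0-descends =
          trans (cong (λ t → b 0 ∧ not t) (subst (λ v → (0 <ᵇ v) ∨ (0 ≡ᵇ m) ≡ true) f0≡0 0∈excedanceSet))
                (∧-zeroʳ (b 0))

      deficiency-≡cycleOf : ∀ {x} → x ≤ m → f x < x → f x ≡ cycleOf m b x
      deficiency-≡cycleOf {x} x≤m fx<x =
        sym (trans (cycleOf-descent m b descent) (lastBelow-unique _ fx<x fx∉b-or-0 between∈b))
        where
        descent : ascends m b x ≡ false
        descent rewrite b≗excedanceSet x x≤m | ≥⇒<ᵇ≡false (<⇒≤ fx<x) = ∧-inverseʳ (x ≡ᵇ m)
        fx∉b-or-0 : not (b (f x)) ≡ true ⊎ f x ≡ 0
        fx∉b-or-0 with 0 <? f x
        ... | no 0≮fx = inj₂ (n≤0⇒n≡0 (≮⇒≥ 0≮fx))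
        ... | yes 0<fx = inj₁ (cong not (non-excedance∉b (<⇒≤ fx<m)
                (≮⇒≥ (deficiency-image-not-excedance x≤m fx<x 0<fx)) (<⇒≢ fx<m)))
          where fx<m = <-≤-trans fx<x x≤m
        between∈b : ∀ {z} → f x < z → z < x → not (b z) ≡ false
        between∈b fx<z z<x =
          cong not (excedance∈b (≤-trans (<⇒≤ z<x) x≤m) (between-deficiency-excedance x≤m fx<z z<x))

    ≡cycleOf : ∀ {x} → x ≤ m → f x ≡ cycleOf m b x
    ≡cycleOf {x} x≤m with <-cmp x (f x)
    ... | tri< x<fx _ _ = excedance-≡cycleOf x≤m x<fx
    ... | tri≈ _ x≡fx _ = fixed-point-≡cycleOf x≤m (sym x≡fx)
    ... | tri> _ _ fx<x = deficiency-≡cycleOf x≤m fx<x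

module CycleOf (m : ℕ) (b : ℕ → Bool) (0∈b : b 0 ≡ true) (m∈b : b m ≡ true) where

  private
    c : ℕ → ℕ
    c = cycleOf m b

    not-b : ℕ → Bool
    not-b y = not (b y)

    ascends⇒≢m : ∀ {x} → ascends m b x ≡ true → x ≢ m
    ascends⇒≢m {x} asc refl rewrite ≡⇒≡ᵇ≡true (refl {x = x}) | ∧-zeroʳ (b x) = true≢false (sym asc)

    ascends⇒∈b : ∀ {x} → ascends m b x ≡ true → b x ≡ true
    ascends⇒∈b {x} asc with b x
    ... | true = refl

    ∈b-descends⇒≡m : ∀ {x} → ascends m b x ≡ false → b x ≡ true → x ≡ m
    ∈b-descends⇒≡m {x} desc x∈b rewrite x∈b with x ≡ᵇ m in x≡ᵇm
    ... | true = ≡ᵇ≡true⇒≡ x≡ᵇm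

    ∈b-≢m⇒ascends : ∀ {x} → b x ≡ true → x ≢ m → ascends m b x ≡ true
    ∈b-≢m⇒ascends x∈b x≢m rewrite x∈b | ≢⇒≡ᵇ≡false x≢m = refl

    ascent-< : ∀ {x} → ascends m b x ≡ true → x < c x
    ascent-< {x} asc rewrite cycleOf-ascent m b asc = firstIn-≥ b (suc x) m

    ascent-≤ : ∀ {x} → x ≤ m → ascends m b x ≡ true → c x ≤ m
    ascent-≤ {x} x≤m asc rewrite cycleOf-ascent m b asc = firstIn-≤ b (≤∧≢⇒< x≤m (ascends⇒≢m asc))

    ascent-∈b : ∀ {x} → x ≤ m → ascends m b x ≡ true → b (c x) ≡ true
    ascent-∈b {x} x≤m asc rewrite cycleOf-ascent m b asc =
      firstIn-satisfies b (≤∧≢⇒< x≤m (ascends⇒≢m asc)) ≤-refl m∈b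

    ascent-skips : ∀ {x y} → ascends m b x ≡ true → x < y → y < c x → b y ≡ false
    ascent-skips {x} asc rewrite cycleOf-ascent m b asc = firstIn-minimal b (suc x) m

    descent-≤ : ∀ {x} → ascends m b x ≡ false → c x ≤ x
    descent-≤ {x} desc rewrite cycleOf-descent m b desc = lastBelow-≤ not-b x

    descent-< : ∀ {x} → ascends m b x ≡ false → 0 < x → c x < x
    descent-< desc 0<x rewrite cycleOf-descent m b desc = lastBelow-< not-b 0<x

    descent-∉b-or-0 : ∀ {x} → ascends m b x ≡ false → b (c x) ≡ false ⊎ c x ≡ 0
    descent-∉b-or-0 {x} desc rewrite cycleOf-descent m b desc with lastBelow-satisfies-or-0 not-b x
    ... | inj₁ ∉b = inj₁ (not-injective {y = false} ∉b)
    ... | inj₂ ≡0 = inj₂ ≡0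

    descent-skips : ∀ {x y} → ascends m b x ≡ false → c x < y → y < x → b y ≡ true
    descent-skips {x} desc cx<y y<x rewrite cycleOf-descent m b desc =
      not-injective {y = true} (lastBelow-maximal not-b x cx<y y<x)

    ascent-or-descent : ∀ x → ascends m b x ≡ true ⊎ ascends m b x ≡ false
    ascent-or-descent x with ascends m b x
    ... | true = inj₁ refl
    ... | false = inj₂ refl

    excedance⇒ascends : ∀ {x} → x < c x → ascends m b x ≡ true
    excedance⇒ascends {x} x<cx with ascent-or-descent x
    ... | inj₁ asc = asc
    ... | inj₂ desc = ⊥-elim (<⇒≱ x<cx (descent-≤ desc))

    non-excedance⇒descends : ∀ {x} → c x ≤ x → ascends m b x ≡ false
    non-excedance⇒descends {x} cx≤x with ascent-or-descent x
    ... | inj₁ asc = ⊥-elim (<⇒≱ (ascent-< asc) cx≤x)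
    ... | inj₂ desc = desc

  bounded : ∀ {x} → x ≤ m → c x ≤ m
  bounded {x} x≤m with ascent-or-descent x
  ... | inj₁ asc = ascent-≤ x≤m asc
  ... | inj₂ desc = ≤-trans (descent-≤ desc) x≤m

  atMostOneUpCrossing : AtMostOneUpCrossing m c
  atMostOneUpCrossing {K} {x} {y} _ x<K y<K K≤cx K≤cy =
    ≤-antisym (≮⇒≥ (λ y<x → two-ups y<x x<K K≤cy K≤cx)) (≮⇒≥ (λ x<y → two-ups x<y y<K K≤cx K≤cy))
    where
    -- v ∈ B would lie strictly between u and c u, the next element of B after u.
    two-ups : ∀ {u v} → u < v → v < K → K ≤ c u → K ≤ c v → ⊥
    two-ups u<v v<K K≤cu K≤cv = true≢false (trans (sym (ascends⇒∈b v-ascends)) v∉b)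
      where
      v-ascends = excedance⇒ascends (<-≤-trans v<K K≤cv)
      u-ascends = excedance⇒ascends (<-≤-trans (<-trans u<v v<K) K≤cu)
      v∉b = ascent-skips u-ascends u<v (<-≤-trans v<K K≤cu)

  atMostOneDownCrossing : AtMostOneDownCrossing m c
  atMostOneDownCrossing {K} {x} {y} x≤m y≤m K≤x K≤y cx<K cy<K =
    ≤-antisym (≮⇒≥ (λ y<x → two-downs y<x x≤m K≤y cy<K cx<K))
              (≮⇒≥ (λ x<y → two-downs x<y y≤m K≤x cx<K cy<K))
    where
    -- q descends past p, so p ∈ B; but m is the only element of B that descends.
    two-downs : ∀ {p q} → p < q → q ≤ m → K ≤ p → c p < K → c q < K → ⊥
    two-downs p<q q≤m K≤p cp<K cq<K = <⇒≢ (<-≤-trans p<q q≤m) (∈b-descends⇒≡m p-descends p∈b)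
      where
      p-descends = non-excedance⇒descends (<⇒≤ (<-≤-trans cp<K K≤p))
      q-descends = non-excedance⇒descends (<⇒≤ (<-≤-trans cq<K (≤-trans K≤p (<⇒≤ p<q))))
      p∈b = descent-skips q-descends (<-≤-trans cq<K K≤p) p<q

  noPositiveFixedPoint : NoPositiveFixedPoint m c
  noPositiveFixedPoint {x} 0<x x≤m cx≡x with ascent-or-descent x
  ... | inj₁ asc = <⇒≢ (ascent-< asc) (sym cx≡x)
  ... | inj₂ desc = <⇒≢ (descent-< desc 0<x) cx≡x

  private
    ascent≢descent : ∀ {x y} → x ≤ m → ascends m b x ≡ true → ascends m b y ≡ false → c x ≢ c y
    ascent≢descent x≤m asc desc cx≡cy with descent-∉b-or-0 desc
    ... | inj₁ cy∉b = true≢false (trans (sym (ascent-∈b x≤m asc)) (trans (cong b cx≡cy) cy∉b))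
    ... | inj₂ cy≡0 = n≮0 (subst (_ <_) (trans cx≡cy cy≡0) (ascent-< asc))

    injective-< : ∀ {x y} → x < y → y ≤ m → c x ≢ c y
    injective-< {x} {y} x<y y≤m cx≡cy with ascent-or-descent x | ascent-or-descent y
    ... | inj₁ ax | inj₁ ay = <⇒≢ (≤-<-trans cx≤y (ascent-< ay)) cx≡cy
      where
      cx≤y : c x ≤ y
      cx≤y = ≮⇒≥ (λ y<cx → true≢false (trans (sym (ascends⇒∈b ay)) (ascent-skips ax x<y y<cx)))
    ... | inj₁ ax | inj₂ ay = ascent≢descent (≤-trans (<⇒≤ x<y) y≤m) ax ay cx≡cy
    ... | inj₂ ax | inj₁ ay = ascent≢descent y≤m ay ax (sym cx≡cy)
    ... | inj₂ ax | inj₂ ay = <⇒≢ (<-≤-trans x<y y≤m) (∈b-descends⇒≡m ax x∈b)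
      where
      x∈b : b x ≡ true
      x∈b with 0 <? x
      ... | no 0≮x = subst (λ v → b v ≡ true) (sym (n≤0⇒n≡0 (≮⇒≥ 0≮x))) 0∈b
      ... | yes 0<x = descent-skips ay (subst (_< x) cx≡cy (descent-< ax 0<x)) x<y

  injective : ∀ {x y} → x ≤ m → y ≤ m → c x ≡ c y → x ≡ y
  injective x≤m y≤m cx≡cy =
    ≤-antisym (≮⇒≥ (λ y<x → injective-< y<x x≤m (sym cx≡cy)))
              (≮⇒≥ (λ x<y → injective-< x<y y≤m cx≡cy))

  indecomposable : ∀ {K} → 1 ≤ K → K ≤ m → ∃ λ i → i < K × K ≤ c i
  indecomposable {K} 1≤K K≤m = i , i<K , ≮⇒≥ (λ ci<K → true≢false
      (trans (sym (ascent-∈b i≤m i-ascends)) (lastBelow-maximal b K (ascent-< i-ascends) ci<K)))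
    where
    i = lastBelow b K
    i<K = lastBelow-< b 1≤K
    i≤m = ≤-trans (<⇒≤ i<K) K≤m
    i-ascends = ∈b-≢m⇒ascends (lastBelow-satisfies b K 1≤K 0∈b) (<⇒≢ (<-≤-trans i<K K≤m))

  isIndecAvoiderOn : IsIndecAvoiderOn m c
  isIndecAvoiderOn = record
    { bounded = bounded
    ; injective = injective
    ; avoids-321 = unique-crossings⇒avoids-321 atMostOneUpCrossing atMostOneDownCrossing noPositiveFixedPoint
    ; avoids-3412 = unique-crossings⇒avoids-3412 atMostOneUpCrossing atMostOneDownCrossing noPositiveFixedPoint
    ; indecomposable = indecomposable
    }

  excedanceSet-cycleOf : ∀ {x} → x ≤ m → excedanceSet m c x ≡ b x
  excedanceSet-cycleOf {x} x≤m with m≤n⇒m<n∨m≡n x≤m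
  ... | inj₂ refl = trans (cong ((x <ᵇ c x) ∨_) (≡⇒≡ᵇ≡true {x} refl)) (trans (∨-zeroʳ _) (sym m∈b))
  ... | inj₁ x<m with ascent-or-descent x
  ...   | inj₁ asc = trans (cong (_∨ (x ≡ᵇ m)) (<⇒<ᵇ≡true (ascent-< asc))) (sym (ascends⇒∈b asc))
  ...   | inj₂ desc = trans (cong₂ _∨_ (≥⇒<ᵇ≡false (descent-≤ desc)) x≢ᵇm) (sym x∉b)
    where
    x≢ᵇm = ≢⇒≡ᵇ≡false (<⇒≢ x<m)
    x∉b : b x ≡ false
    x∉b = trans (sym (∧-identityʳ (b x))) (trans (cong (λ t → b x ∧ not t) (sym x≢ᵇm)) desc)

-- Partitions of [0, m] as Boolean relations on ℕ

ArcOn : ℕ → (ℕ → ℕ → Bool) → ℕ → ℕ → Set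
ArcOn m r a b = a < b × b ≤ m × r a b ≡ true × (∀ {k} → a < k → k < b → r a k ≡ false)

arc-from : ∀ {m} r {i j} → i < j → j ≤ m → r i j ≡ true → ∃ λ b → ArcOn m r i b
arc-from {m} r {i} i<j j≤m rij =
  firstIn (r i) (suc i) m , firstIn-≥ (r i) (suc i) m , firstIn-≤ (r i) (<-≤-trans i<j j≤m) ,
  firstIn-satisfies (r i) i<j j≤m rij , firstIn-minimal (r i) (suc i) m

blockPartition : (ℕ → Bool) → ℕ → ℕ → Bool
blockPartition b i j = (i ≡ᵇ j) ∨ (b i ∧ b j)

record IsNCNNIndecOn (m : ℕ) (r : ℕ → ℕ → Bool) : Set where
  field
    reflexive : ∀ i → r i i ≡ true
    symmetric : ∀ {i j} → r i j ≡ true → r j i ≡ true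
    transitive : ∀ {i j k} → r i j ≡ true → r j k ≡ true → r i k ≡ true
    noncrossing : ∀ {a b c d} → ArcOn m r a b → ArcOn m r c d → a < c → c < b → b < d → ⊥
    nonnesting : ∀ {a b c d} → ArcOn m r a b → ArcOn m r c d → a < c → c < d → d < b → ⊥
    indecomposable : ∀ {K} → 1 ≤ K → K ≤ m → ∃₂ λ i j → i < K × K ≤ j × j ≤ m × r i j ≡ true

module IsNCNNIndecOn-Properties {m r} (ncnn : IsNCNNIndecOn m r) where
  open IsNCNNIndecOn ncnn public

  arcs-unlinked : ∀ {a b c d} → ArcOn m r a b → ArcOn m r c d → a < c → c < b → ⊥
  arcs-unlinked {a} {b} {c} {d} A@(_ , _ , rab , a-skips) C@(c<d , _ , rcd , _) a<c c<b with <-cmp b d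
  ... | tri< b<d _ _ = noncrossing A C a<c c<b b<d
  ... | tri> _ _ d<b = nonnesting A C a<c c<d d<b
  ... | tri≈ _ refl _ = true≢false (trans (sym (transitive rab (symmetric rcd))) (a-skips a<c c<b))

  arc-across : ∀ {i j K} → i < K → K ≤ j → j ≤ m → r i j ≡ true →
               ∃₂ λ a b → ArcOn m r a b × a < K × K ≤ b
  arc-across {i} {j} {K} i<K K≤j j≤m rij = a , b , A , a<K , ≮⇒≥ b≮K
    where
    a = lastBelow (r i) K
    a<K = lastBelow-< (r i) (≤-<-trans z≤n i<K)
    ria = lastBelow-satisfies (r i) K i<K (reflexive i)
    arc = arc-from r (<-≤-trans a<K K≤j) j≤m (transitive (symmetric ria) rij)
    b = proj₁ arc
    A = proj₂ arc
    b≮K : ¬ b < K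
    b≮K b<K = true≢false (trans (sym (transitive ria (proj₁ (proj₂ (proj₂ A)))))
                                (lastBelow-maximal (r i) K (proj₁ A) b<K))

  -- The least element a of the block of i is 0: otherwise the arc over the cut a, which exists
  -- by indecomposability and cannot end at a, would be linked with the arc leaving a.
  ∼-above⇒∼0 : ∀ {i j} → i < j → j ≤ m → r i j ≡ true → r 0 i ≡ true
  ∼-above⇒∼0 {i} {j} i<j j≤m rij = symmetric (subst (λ z → r i z ≡ true) a≡0 ria)
    where
    a = firstIn (r i) 0 i
    a≤i = firstIn-≤ (r i) z≤n
    a≤m = ≤-trans a≤i (≤-trans (<⇒≤ i<j) j≤m)
    ria = firstIn-satisfies (r i) z≤n ≤-refl (reflexive i)

    arc-over-a-ends-after-a : ∀ {a′ b′} → ArcOn m r a′ b′ → a′ < a → a ≤ b′ → a < b′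
    arc-over-a-ends-after-a {a′} (_ , _ , ra′b′ , _) a′<a a≤b′ = ≤∧≢⇒< a≤b′ λ a≡b′ → true≢false
      (trans (sym (transitive ria (symmetric (subst (λ z → r a′ z ≡ true) (sym a≡b′) ra′b′))))
             (firstIn-minimal (r i) 0 i z≤n a′<a))

    0≮a : ¬ 0 < a
    0≮a 0<a with indecomposable 0<a a≤m
    ... | p , q , p<a , a≤q , q≤m , rpq with arc-across p<a a≤q q≤m rpq
    ...   | a′ , b′ , A′ , a′<a , a≤b′ =
      arcs-unlinked A′ (proj₂ (arc-from r (≤-<-trans a≤i i<j) j≤m (transitive (symmetric ria) rij)))
        a′<a (arc-over-a-ends-after-a A′ a′<a a≤b′)

    a≡0 : a ≡ 0
    a≡0 = n≤0⇒n≡0 (≮⇒≥ 0≮a)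

  0∼m : r 0 m ≡ true
  0∼m with 0 <? m
  ... | no 0≮m = subst (λ z → r 0 z ≡ true) (sym (n≤0⇒n≡0 (≮⇒≥ 0≮m))) (reflexive 0)
  ... | yes 0<m with indecomposable 0<m ≤-refl
  ...   | i , j , i<m , m≤j , j≤m , rij = transitive (∼-above⇒∼0 i<m ≤-refl rim) rim
    where rim = subst (λ z → r i z ≡ true) (≤-antisym j≤m m≤j) rij

  ≡blockPartition : ∀ {i j} → i ≤ m → j ≤ m → r i j ≡ blockPartition (r 0) i j
  ≡blockPartition {i} {j} i≤m j≤m with i ≟ j
  ... | yes refl rewrite ≡⇒≡ᵇ≡true (refl {x = i}) = reflexive i
  ... | no i≢j rewrite ≢⇒≡ᵇ≡false i≢j = ⇔→≡ (mk⇔ both-in-block-of-0 linked-via-0)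
    where
    both-in-block-of-0 : r i j ≡ true → r 0 i ∧ r 0 j ≡ true
    both-in-block-of-0 rij with <-cmp i j
    ... | tri< i<j _ _ = let r0i = ∼-above⇒∼0 i<j j≤m rij in cong₂ _∧_ r0i (transitive r0i rij)
    ... | tri≈ _ i≡j _ = ⊥-elim (i≢j i≡j)
    ... | tri> _ _ j<i =
      let r0j = ∼-above⇒∼0 j<i i≤m (symmetric rij) in cong₂ _∧_ (transitive r0j (symmetric rij)) r0j
    linked-via-0 : r 0 i ∧ r 0 j ≡ true → r i j ≡ true
    linked-via-0 r0i∧r0j = let (r0i , r0j) = ∧≡true⇒ r0i∧r0j in transitive (symmetric r0i) r0j

module BlockPartition (m : ℕ) (b : ℕ → Bool) (0∈b : b 0 ≡ true) (m∈b : b m ≡ true) where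

  private
    s : ℕ → ℕ → Bool
    s = blockPartition b

    linked⇒∈b : ∀ {i j} → i ≢ j → s i j ≡ true → b i ≡ true × b j ≡ true
    linked⇒∈b i≢j sij rewrite ≢⇒≡ᵇ≡false i≢j = ∧≡true⇒ sij

    ∈b⇒linked : ∀ {i j} → b i ≡ true → b j ≡ true → s i j ≡ true
    ∈b⇒linked {i} {j} bi bj rewrite bi | bj = ∨-zeroʳ (i ≡ᵇ j)

    arcs-unlinked : ∀ {a a′ c c′} → ArcOn m s a a′ → ArcOn m s c c′ → a < c → c < a′ → ⊥
    arcs-unlinked (a<a′ , _ , saa′ , a-skips) (c<c′ , _ , scc′ , _) a<c c<a′ = true≢false (trans
      (sym (∈b⇒linked (proj₁ (linked⇒∈b (<⇒≢ a<a′) saa′)) (proj₁ (linked⇒∈b (<⇒≢ c<c′) scc′))))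
      (a-skips a<c c<a′))

  isNCNNIndecOn : IsNCNNIndecOn m (blockPartition b)
  isNCNNIndecOn = record
    { reflexive = reflexive
    ; symmetric = symmetric
    ; transitive = transitive
    ; noncrossing = λ A C a<c c<b _ → arcs-unlinked A C a<c c<b
    ; nonnesting = λ A C a<c c<d d<b → arcs-unlinked A C a<c (<-trans c<d d<b)
    ; indecomposable = λ 1≤K K≤m → 0 , m , 1≤K , K≤m , ≤-refl , ∈b⇒linked 0∈b m∈b
    }
    where
    reflexive : ∀ i → s i i ≡ true
    reflexive i rewrite ≡⇒≡ᵇ≡true (refl {x = i}) = refl

    symmetric : ∀ {i j} → s i j ≡ true → s j i ≡ true
    symmetric {i} {j} sij with i ≟ j
    ... | yes refl = sij
    ... | no i≢j = ∈b⇒linked (proj₂ (linked⇒∈b i≢j sij)) (proj₁ (linked⇒∈b i≢j sij))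

    transitive : ∀ {i j k} → s i j ≡ true → s j k ≡ true → s i k ≡ true
    transitive {i} {j} {k} sij sjk with i ≟ j | j ≟ k
    ... | yes refl | _ = sjk
    ... | no _ | yes refl = sij
    ... | no i≢j | no j≢k = ∈b⇒linked (proj₁ (linked⇒∈b i≢j sij)) (proj₂ (linked⇒∈b j≢k sjk))

  block-of-0 : ∀ x → blockPartition b 0 x ≡ b x
  block-of-0 zero rewrite 0∈b = refl
  block-of-0 (suc x) rewrite 0∈b = refl

clamp : (m v : ℕ) → Fin (suc m)
clamp _ zero = fzero
clamp zero (suc _) = fzero
clamp (suc m) (suc v) = fsuc (clamp m v)

toℕ-clamp : ∀ {m v} → v ≤ m → toℕ (clamp m v) ≡ v
toℕ-clamp {_} {zero} _ = refl
toℕ-clamp {suc m} {suc v} (s≤s v≤m) = cong suc (toℕ-clamp v≤m)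

clamp-toℕ : ∀ {m} (i : Fin (suc m)) → clamp m (toℕ i) ≡ i
clamp-toℕ fzero = refl
clamp-toℕ {suc m} (fsuc i) = cong fsuc (clamp-toℕ i)

toℕ≤ : ∀ {m} (i : Fin (suc m)) → toℕ i ≤ m
toℕ≤ i = ≤-pred (toℕ<n i)

clamp-< : ∀ {m u v} → u < v → v ≤ m → toℕ (clamp m u) < toℕ (clamp m v)
clamp-< u<v v≤m = subst₂ _<_ (sym (toℕ-clamp (≤-trans (<⇒≤ u<v) v≤m))) (sym (toℕ-clamp v≤m)) u<v

entry : ∀ {m} → Rel (suc m) → ℕ → ℕ → Bool
entry {m} R i j = lookup (lookup R (clamp m i)) (clamp m j)

entry-toℕ : ∀ {m} (R : Rel (suc m)) i j → entry R (toℕ i) (toℕ j) ≡ lookup (lookup R i) j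
entry-toℕ R i j rewrite clamp-toℕ i | clamp-toℕ j = refl

_atℕ_ : ∀ {m} → Vec (Fin (suc m)) (suc m) → ℕ → ℕ
_atℕ_ {m} w x = w at clamp m x

atℕ-toℕ : ∀ {m} (w : Vec (Fin (suc m)) (suc m)) i → w atℕ toℕ i ≡ w at i
atℕ-toℕ w i rewrite clamp-toℕ i = refl

module _ {m} {R : Rel (suc m)} where

  ArcOn⇒Arc : ∀ {a b} → ArcOn m (entry R) a b → Arc R (clamp m a) (clamp m b)
  ArcOn⇒Arc {a} {b} (a<b , b≤m , rab , a-skips) = clamp-< a<b b≤m , rab , skips
    where
    a≡ = toℕ-clamp (≤-trans (<⇒≤ a<b) b≤m)
    skips : ∀ k → toℕ (clamp m a) < toℕ k → toℕ k < toℕ (clamp m b) → ¬ (clamp m a ∼[ R ] k)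
    skips k a<k k<b a∼k = true≢false (trans (sym a∼k)
      (subst (λ z → lookup (lookup R (clamp m a)) z ≡ false) (clamp-toℕ k)
        (a-skips (subst (_< toℕ k) a≡ a<k) (subst (toℕ k <_) (toℕ-clamp b≤m) k<b))))

  isNCNNIndecPartition⇒On : IsNCNNIndecPartition R → IsNCNNIndecOn m (entry R)
  isNCNNIndecPartition⇒On (sp , ¬crossing , ¬nesting , ¬decomposable) = record
    { reflexive = λ i → IsSetPartition.refl sp (clamp m i)
    ; symmetric = λ {i} {j} → IsSetPartition.sym sp (clamp m i) (clamp m j)
    ; transitive = λ {i} {j} {k} → IsSetPartition.trans sp (clamp m i) (clamp m j) (clamp m k)
    ; noncrossing = λ A C a<c c<b b<d → ¬crossing (_ , _ , _ , _ , ArcOn⇒Arc A , ArcOn⇒Arc C ,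
        clamp-< a<c (start≤m C) , clamp-< c<b (end≤m A) , clamp-< b<d (end≤m C))
    ; nonnesting = λ A C a<c c<d d<b → ¬nesting (_ , _ , _ , _ , ArcOn⇒Arc A , ArcOn⇒Arc C ,
        clamp-< a<c (start≤m C) , clamp-< c<d (end≤m C) , clamp-< d<b (end≤m A))
    ; indecomposable = indecomposable
    }
    where
    end≤m : ∀ {a b} → ArcOn m (entry R) a b → b ≤ m
    end≤m (_ , b≤m , _) = b≤m
    start≤m : ∀ {a b} → ArcOn m (entry R) a b → a ≤ m
    start≤m (a<b , b≤m , _) = ≤-trans (<⇒≤ a<b) b≤m

    -- Bounded search turns the negative ¬ PartDecomposable into an explicit pair over the cut.
    indecomposable : ∀ {K} → 1 ≤ K → K ≤ m → ∃₂ λ i j → i < K × K ≤ j × j ≤ m × entry R i j ≡ true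
    indecomposable {K} 1≤K K≤m
      with anyUpTo? (λ i → anyUpTo? (λ j → K ≤? j ×-dec entry R i j ≟ᵇ true) (suc m)) K
    ... | yes (i , i<K , j , j<1+m , K≤j , rij) = i , j , i<K , K≤j , ≤-pred j<1+m , rij
    ... | no none = ⊥-elim (¬decomposable (K , 1≤K , s≤s K≤m , λ i j i<K K≤j i∼j →
            none (toℕ i , i<K , toℕ j , toℕ<n j , K≤j , trans (entry-toℕ R i j) i∼j)))

module _ {m} {R : Rel (suc m)} {r : ℕ → ℕ → Bool}
         (R≗r : ∀ i j → lookup (lookup R i) j ≡ r (toℕ i) (toℕ j)) where

  Arc⇒ArcOn : ∀ {i j} → Arc R i j → ArcOn m r (toℕ i) (toℕ j)
  Arc⇒ArcOn {i} {j} (i<j , i∼j , i-skips) = i<j , toℕ≤ j , trans (sym (R≗r i j)) i∼j , skips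
    where
    skips : ∀ {k} → toℕ i < k → k < toℕ j → r (toℕ i) k ≡ false
    skips {k} i<k k<j = ¬-not λ rik →
        i-skips (clamp m k) (subst (toℕ i <_) (sym k≡) i<k) (subst (_< toℕ j) (sym k≡) k<j)
          (trans (R≗r i (clamp m k)) (subst (λ z → r (toℕ i) z ≡ true) (sym k≡) rik))
      where k≡ = toℕ-clamp (≤-trans (<⇒≤ k<j) (toℕ≤ j))

  On⇒isNCNNIndecPartition : IsNCNNIndecOn m r → IsNCNNIndecPartition R
  On⇒isNCNNIndecPartition ncnn = setPartition , ¬crossing , ¬nesting , ¬decomposable
    where
    open IsNCNNIndecOn ncnn
    setPartition : IsSetPartition R
    setPartition = record
      { refl = λ i → trans (R≗r i i) (reflexive (toℕ i))
      ; sym = λ i j i∼j → trans (R≗r j i) (symmetric (trans (sym (R≗r i j)) i∼j))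
      ; trans = λ i j k i∼j j∼k → trans (R≗r i k)
          (transitive (trans (sym (R≗r i j)) i∼j) (trans (sym (R≗r j k)) j∼k))
      }
    ¬crossing : ¬ HasCrossing R
    ¬crossing (_ , _ , _ , _ , A , C , a<c , c<b , b<d) = noncrossing (Arc⇒ArcOn A) (Arc⇒ArcOn C) a<c c<b b<d
    ¬nesting : ¬ HasNesting R
    ¬nesting (_ , _ , _ , _ , A , C , a<c , c<d , d<b) = nonnesting (Arc⇒ArcOn A) (Arc⇒ArcOn C) a<c c<d d<b
    ¬decomposable : ¬ PartDecomposable R
    ¬decomposable (K , 1≤K , K<1+m , split) with indecomposable 1≤K (≤-pred K<1+m)
    ... | i , j , i<K , K≤j , j≤m , rij = split (clamp m i) (clamp m j)
          (subst (_< K) (sym i≡) i<K) (subst (K ≤_) (sym j≡) K≤j)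
          (trans (R≗r _ _) (subst₂ (λ x y → r x y ≡ true) (sym i≡) (sym j≡) rij))
      where
      i≡ = toℕ-clamp (≤-trans (<⇒≤ i<K) (≤-pred K<1+m))
      j≡ = toℕ-clamp j≤m

module _ {m} {w : Vec (Fin (suc m)) (suc m)} where

  isIndecAvoider⇒On : IsIndecAvoider w → IsIndecAvoiderOn m (w atℕ_)
  isIndecAvoider⇒On (perm , ¬321 , ¬3412 , ¬decomposable) = record
    { bounded = λ _ → toℕ≤ _
    ; injective = λ x≤m y≤m wx≡wy → trans (sym (toℕ-clamp x≤m))
        (trans (cong toℕ (perm _ _ (toℕ-injective wx≡wy))) (toℕ-clamp y≤m))
    ; avoids-321 = λ a<b b<c c≤m wc<wb wb<wa → ¬321 (_ , _ , _ ,
        clamp-< a<b (≤-trans (<⇒≤ b<c) c≤m) , clamp-< b<c c≤m , wc<wb , wb<wa)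
    ; avoids-3412 = λ a<b b<c c<d d≤m wc<wd wd<wa wa<wb → ¬3412 (_ , _ , _ , _ ,
        clamp-< a<b (≤-trans (<⇒≤ (<-trans b<c c<d)) d≤m) , clamp-< b<c (≤-trans (<⇒≤ c<d) d≤m) ,
        clamp-< c<d d≤m , wc<wd , wd<wa , wa<wb)
    ; indecomposable = indecomposable
    }
    where
    indecomposable : ∀ {K} → 1 ≤ K → K ≤ m → ∃ λ i → i < K × K ≤ w atℕ i
    indecomposable {K} 1≤K K≤m with anyUpTo? (λ i → K ≤? w atℕ i) K
    ... | yes found = found
    ... | no none = ⊥-elim (¬decomposable (K , 1≤K , s≤s K≤m , λ i i<K →
            ≰⇒> (λ K≤wi → none (toℕ i , i<K , subst (K ≤_) (sym (atℕ-toℕ w i)) K≤wi))))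

  On⇒isIndecAvoider : ∀ {g} → (∀ i → w at i ≡ g (toℕ i)) → IsIndecAvoiderOn m g → IsIndecAvoider w
  On⇒isIndecAvoider {g} w≗g av = perm , ¬321 , ¬3412 , ¬decomposable
    where
    open IsIndecAvoiderOn av
    perm : IsPermutation w
    perm i j wi≡wj = toℕ-injective (injective (toℕ≤ i) (toℕ≤ j)
      (trans (sym (w≗g i)) (trans (cong toℕ wi≡wj) (w≗g j))))
    ¬321 : ¬ Contains321 w
    ¬321 (a , b , c , a<b , b<c , wc<wb , wb<wa) =
      avoids-321 a<b b<c (toℕ≤ c) (subst₂ _<_ (w≗g c) (w≗g b) wc<wb) (subst₂ _<_ (w≗g b) (w≗g a) wb<wa)
    ¬3412 : ¬ Contains3412 w
    ¬3412 (a , b , c , d , a<b , b<c , c<d , wc<wd , wd<wa , wa<wb) =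
      avoids-3412 a<b b<c c<d (toℕ≤ d) (subst₂ _<_ (w≗g c) (w≗g d) wc<wd)
        (subst₂ _<_ (w≗g d) (w≗g a) wd<wa) (subst₂ _<_ (w≗g a) (w≗g b) wa<wb)
    ¬decomposable : ¬ PermDecomposable w
    ¬decomposable (K , 1≤K , K<1+m , split) with indecomposable 1≤K (≤-pred K<1+m)
    ... | i , i<K , K≤gi = <⇒≱ (split (clamp m i) (subst (_< K) (sym i≡) i<K))
          (subst (K ≤_) (sym (trans (w≗g (clamp m i)) (cong g i≡))) K≤gi)
      where i≡ = toℕ-clamp (≤-trans (<⇒≤ i<K) (≤-pred K<1+m))

member : ∀ {m} → Vec Bool (suc m) → ℕ → Bool
member {m} v x = lookup v (clamp m x)

member-toℕ : ∀ {m} (v : Vec Bool (suc m)) i → member v (toℕ i) ≡ lookup v i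
member-toℕ v i = cong (lookup v) (clamp-toℕ i)

member-tabulate : ∀ {m} (g : ℕ → Bool) {x} → x ≤ m → member (tabulate {n = suc m} (λ i → g (toℕ i))) x ≡ g x
member-tabulate {m} g {x} x≤m = trans (lookup∘tabulate (λ i → g (toℕ i)) (clamp m x)) (cong g (toℕ-clamp x≤m))

SubsetsWithEnds : ℕ → Setoid 0ℓ 0ℓ
SubsetsWithEnds m = On.setoid {B = Σ (Vec Bool (suc m)) λ v → member v 0 ≡ true × member v m ≡ true}
                              (PE.setoid (Vec Bool (suc m))) proj₁

module _ (m : ℕ) where

  blockMatrix : Vec Bool (suc m) → Rel (suc m)
  blockMatrix v = tabulate λ i → tabulate λ j → blockPartition (member v) (toℕ i) (toℕ j)

  blockMatrix-lookup : ∀ v i j → lookup (lookup (blockMatrix v) i) j ≡ blockPartition (member v) (toℕ i) (toℕ j)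
  blockMatrix-lookup v i j =
    trans (cong (λ row → lookup row j) (lookup∘tabulate (λ i → tabulate (row i)) i)) (lookup∘tabulate (row i) j)
    where row = λ i j → blockPartition (member v) (toℕ i) (toℕ j)

  module _ (v : Vec Bool (suc m)) (0∈v : member v 0 ≡ true) (m∈v : member v m ≡ true) where
    open BlockPartition m (member v) 0∈v m∈v

    blockMatrix-valid : IsNCNNIndecPartition (blockMatrix v)
    blockMatrix-valid = On⇒isNCNNIndecPartition (blockMatrix-lookup v) isNCNNIndecOn

    row-0-blockMatrix : lookup (blockMatrix v) fzero ≡ v
    row-0-blockMatrix =
      trans (tabulate-cong λ j → trans (block-of-0 (toℕ j)) (member-toℕ v j)) (tabulate∘lookup v)

  module _ (R : Rel (suc m)) (ncnn : IsNCNNIndecPartition R) where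
    open IsNCNNIndecOn-Properties (isNCNNIndecPartition⇒On ncnn)

    row-0-contains-0 : member (lookup R fzero) 0 ≡ true
    row-0-contains-0 = reflexive 0

    row-0-contains-m : member (lookup R fzero) m ≡ true
    row-0-contains-m = 0∼m

    blockMatrix-row-0 : blockMatrix (lookup R fzero) ≡ R
    blockMatrix-row-0 =
      trans (tabulate-cong λ i → trans (tabulate-cong λ j → trans (sym (≡blockPartition (toℕ≤ i) (toℕ≤ j)))
                                                                  (entry-toℕ R i j))
                                       (tabulate∘lookup (lookup R i)))
            (tabulate∘lookup R)

  partitions↔subsets : Inverse (NCNNIndecPartitions (suc m)) (SubsetsWithEnds m)
  partitions↔subsets = record
    { to = λ (R , ncnn) → lookup R fzero , row-0-contains-0 R ncnn , row-0-contains-m R ncnn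
    ; from = λ (v , 0∈v , m∈v) → blockMatrix v , blockMatrix-valid v 0∈v m∈v
    ; to-cong = cong (λ R → lookup R fzero)
    ; from-cong = cong blockMatrix
    ; inverse = (λ { {v , 0∈v , m∈v} R≡ →
                      trans (cong (λ R → lookup R fzero) R≡) (row-0-blockMatrix v 0∈v m∈v) })
              , (λ { {R , ncnn} v≡ → trans (cong blockMatrix v≡) (blockMatrix-row-0 R ncnn) })
    }

  excedanceVec : Vec (Fin (suc m)) (suc m) → Vec Bool (suc m)
  excedanceVec w = tabulate λ i → excedanceSet m (w atℕ_) (toℕ i)

  cycleVec : Vec Bool (suc m) → Vec (Fin (suc m)) (suc m)
  cycleVec v = tabulate λ i → clamp m (cycleOf m (member v) (toℕ i))

  module _ (v : Vec Bool (suc m)) (0∈v : member v 0 ≡ true) (m∈v : member v m ≡ true) where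
    open CycleOf m (member v) 0∈v m∈v

    cycleVec-at : ∀ i → cycleVec v at i ≡ cycleOf m (member v) (toℕ i)
    cycleVec-at i = trans (cong toℕ (lookup∘tabulate (λ i → clamp m (cycleOf m (member v) (toℕ i))) i))
                          (toℕ-clamp (bounded (toℕ≤ i)))

    cycleVec-valid : IsIndecAvoider (cycleVec v)
    cycleVec-valid = On⇒isIndecAvoider {w = cycleVec v} cycleVec-at isIndecAvoiderOn

    excedanceVec-cycleVec : excedanceVec (cycleVec v) ≡ v
    excedanceVec-cycleVec = trans (tabulate-cong λ i → begin
        excedanceSet m (cycleVec v atℕ_) (toℕ i)
          ≡⟨ cong (λ y → (toℕ i <ᵇ y) ∨ (toℕ i ≡ᵇ m))
                  (trans (atℕ-toℕ (cycleVec v) i) (cycleVec-at i)) ⟩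
        excedanceSet m (cycleOf m (member v)) (toℕ i)
          ≡⟨ excedanceSet-cycleOf (toℕ≤ i) ⟩
        member v (toℕ i)
          ≡⟨ member-toℕ v i ⟩
        lookup v i ∎) (tabulate∘lookup v)
      where open ≡-Reasoning

  module _ (w : Vec (Fin (suc m)) (suc m)) (av : IsIndecAvoider w) where
    open IsIndecAvoiderOn-Properties (isIndecAvoider⇒On {w = w} av)

    excedanceVec-contains-0 : member (excedanceVec w) 0 ≡ true
    excedanceVec-contains-0 = trans (member-tabulate {m} (excedanceSet m (w atℕ_)) z≤n) 0∈excedanceSet

    excedanceVec-contains-m : member (excedanceVec w) m ≡ true
    excedanceVec-contains-m = trans (member-tabulate (excedanceSet m (w atℕ_)) ≤-refl)
                           (trans (cong ((m <ᵇ w atℕ m) ∨_) (≡⇒≡ᵇ≡true {m} refl)) (∨-zeroʳ _))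

    cycleVec-excedanceVec : cycleVec (excedanceVec w) ≡ w
    cycleVec-excedanceVec = trans (tabulate-cong λ i → begin
        clamp m (cycleOf m (member (excedanceVec w)) (toℕ i))
          ≡⟨ cong (clamp m) (sym (≡cycleOf (λ x → member-tabulate (excedanceSet m (w atℕ_))) (toℕ≤ i))) ⟩
        clamp m (w atℕ toℕ i)
          ≡⟨ cong (clamp m) (atℕ-toℕ w i) ⟩
        clamp m (w at i)
          ≡⟨ clamp-toℕ (lookup w i) ⟩
        lookup w i ∎) (tabulate∘lookup w)
      where open ≡-Reasoning

  permutations↔subsets : Inverse (IndecPerms321-3412 (suc m)) (SubsetsWithEnds m)
  permutations↔subsets = record
    { to = λ (w , av) → excedanceVec w , excedanceVec-contains-0 w av , excedanceVec-contains-m w av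
    ; from = λ (v , 0∈v , m∈v) → cycleVec v , cycleVec-valid v 0∈v m∈v
    ; to-cong = cong excedanceVec
    ; from-cong = cong cycleVec
    ; inverse = (λ { {v , 0∈v , m∈v} w≡ → trans (cong excedanceVec w≡) (excedanceVec-cycleVec v 0∈v m∈v) })
              , (λ { {w , av} v≡ → trans (cong cycleVec v≡) (cycleVec-excedanceVec w av) })
    }

mainTheorem7 : (n : ℕ) → 1 ≤ n → Bijection (NCNNIndecPartitions n) (IndecPerms321-3412 n)
mainTheorem7 (suc m) _ =
  Inverse⇒Bijection (Composition.inverse (partitions↔subsets m) (Symmetry.inverse (permutations↔subsets m)))
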